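{- Let $f:\{0,1\}^n\to\{ -1,1\}$ and let $D$ be an $n\times n$ matrix over $\mathbb{F}_2$. Define $F:\{0,1\}^n\to\mathbb{R}$ by $F(z)=\sum_{y\in\{0,1\}^n}\widehat{f_y}^{\,2}(Dy+z)$. Then for every $x\in\{0,1\}^n$, $$\hat F(x)=\widehat{f_x}^{\,2}(D^tx).$$
   Context: Addition is in $\mathbb{F}_2^n$; $f_y(u)=f(u)f(u+y)$; for $h:\{0,1\}^n\to\mathbb{R}$, $\hat h(\alpha)=\mathbb{E}_u h(u)(-1)^{\langle\alpha,u\rangle}$ with $u$ uniform and $\langle\alpha,u\rangle=\sum_i\alpha_iu_i\bmod2$. $D^t$ is the transpose of $D$. -}

module Defs where

open import Data.Nat using (ℕ; zero; suc)
open import Data.Bool using (Bool; true; false; _xor_; _∧_)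
open import Data.Vec using (Vec; []; _∷_; zipWith; foldr; map; transpose)
open import Data.List using (List; []; _∷_; _++_) renaming (map to lmap)
open import Data.Rational using (ℚ; 0ℚ; 1ℚ; -_; ½; _+_; _*_)

-- The cube {0,1}^n = 𝔽₂^n, with false = 0, true = 1.
Cube : ℕ → Set
Cube n = Vec Bool n

_⊕_ : ∀ {n} → Cube n → Cube n → Cube n
_⊕_ = zipWith _xor_

⟨_,_⟩ : ∀ {n} → Cube n → Cube n → Bool
⟨ α , u ⟩ = foldr _ _xor_ false (zipWith _∧_ α u)

sgn : Bool → ℚ
sgn false = 1ℚ
sgn true  = - 1ℚ

-- n×n matrices over 𝔽₂, given as a vector of rows.
Mat : ℕ → Set
Mat n = Vec (Vec Bool n) n

_·_ : ∀ {n} → Mat n → Cube n → Cube n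
D · y = map (λ row → ⟨ row , y ⟩) D

_ᵗ : ∀ {n} → Mat n → Mat n
D ᵗ = transpose D

allCube : (n : ℕ) → List (Cube n)
allCube zero    = [] ∷ []
allCube (suc n) = lmap (false ∷_) (allCube n) ++ lmap (true ∷_) (allCube n)

sumℚ : List ℚ → ℚ
sumℚ []       = 0ℚ
sumℚ (q ∷ qs) = q + sumℚ qs

Σcube : (n : ℕ) → (Cube n → ℚ) → ℚ
Σcube n h = sumℚ (lmap h (allCube n))

half^ : ℕ → ℚ
half^ zero    = 1ℚ
half^ (suc n) = ½ * half^ n

𝔼 : (n : ℕ) → (Cube n → ℚ) → ℚ
𝔼 n h = half^ n * Σcube n h

hat : ∀ {n} → (Cube n → ℚ) → Cube n → ℚ
hat {n} h α = 𝔼 n (λ u → h u * sgn ⟨ α , u ⟩)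

deriv : ∀ {n} → (Cube n → ℚ) → Cube n → Cube n → ℚ
deriv f y u = f u * f (u ⊕ y)

bigF : ∀ {n} → (Cube n → ℚ) → Mat n → Cube n → ℚ
bigF {n} f D z = Σcube n (λ y → hat (deriv f y) ((D · y) ⊕ z) * hat (deriv f y) ((D · y) ⊕ z))

{-# OPTIONS --safe #-}
module Submission where

-- Exchanging the two sums and translating by Dy, F̂(x) = Σ_y (−1)^⟨x,Dy⟩ (f̂_y²)^(x).
-- By Wiener–Khinchin the Fourier transform of the autocorrelation A_g(y) = 𝔼_u g(u) g(u+y)
-- is ĝ², so by Fourier inversion (ĝ²)^ = 2⁻ⁿ A_g.  The autocorrelation of f_y at x is
-- symmetric in x and y, both being 𝔼_u f(u) f(u+x) f(u+y) f(u+x+y).  Writing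
-- ⟨x,Dy⟩ = ⟨Dᵗx,y⟩, F̂(x) becomes the Fourier transform of A_{f_x} at Dᵗx, which is
-- f̂_x(Dᵗx)² by Wiener–Khinchin once more.

open import Defs
open import Algebra using (CommutativeMonoid; CommutativeRing)
import Algebra.Properties.CommutativeSemigroup as CommSemigroupProperties
open import Data.Bool using (Bool; true; false; not; _xor_; _∧_)
open import Data.Bool.Properties
  using (∧-distribˡ-xor; ∧-zeroʳ; xor-assoc; xor-comm; xor-identityʳ; xor-same; xor-∧-commutativeRing)
open import Data.List using (List; []; _∷_; _++_) renaming (map to lmap)
import Data.List.Properties as List
open import Data.Nat using (ℕ; zero; suc)
open import Data.Rational using (ℚ; 0ℚ; 1ℚ; ½; -_; _+_; _*_)
open import Data.Rational.Properties
  using (+-assoc; +-comm; +-identityˡ; +-identityʳ; *-assoc; *-identityʳ; *-zeroˡ; *-zeroʳ; *-distribˡ-+; *-distribʳ-+;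
         +-0-commutativeMonoid; *-1-commutativeMonoid)
open import Data.Rational.Solver using (module +-*-Solver)
open import Data.Sum using (_⊎_)
open import Data.Vec using (Vec; []; _∷_; map; replicate; transpose; _⊛_)
import Data.Vec.Properties as Vec
open import Data.Vec.Relation.Binary.Pointwise.Inductive using (Pointwise-≡⇒≡; zipWith-comm; zipWith-identityʳ)
open import Relation.Binary.PropositionalEquality using (_≡_; refl; sym; trans; cong; cong₂; module ≡-Reasoning)

open ≡-Reasoning

private
  variable
    A B : Set

private
  module 𝔽₂ = CommutativeRing xor-∧-commutativeRing
  module xor = CommSemigroupProperties 𝔽₂.+-commutativeSemigroup
  module ∧ = CommSemigroupProperties 𝔽₂.*-commutativeSemigroup
  module +ℚ = CommSemigroupProperties (CommutativeMonoid.commutativeSemigroup +-0-commutativeMonoid)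
  module *ℚ = CommSemigroupProperties (CommutativeMonoid.commutativeSemigroup *-1-commutativeMonoid)

-- The group 𝔽₂ⁿ and the inner product

⊕-comm : ∀ {n} (u v : Cube n) → u ⊕ v ≡ v ⊕ u
⊕-comm u v = Pointwise-≡⇒≡ (zipWith-comm xor-comm u v)

⊕-identityʳ : ∀ {n} (u : Cube n) → u ⊕ replicate n false ≡ u
⊕-identityʳ u = Pointwise-≡⇒≡ (zipWith-identityʳ xor-identityʳ u)

x⊕[x⊕y]≡y : ∀ {n} (u v : Cube n) → u ⊕ (u ⊕ v) ≡ v
x⊕[x⊕y]≡y []      []      = refl
x⊕[x⊕y]≡y (a ∷ u) (b ∷ v) =
  cong₂ _∷_ (trans (sym (xor-assoc a a b)) (cong (_xor b) (xor-same a))) (x⊕[x⊕y]≡y u v)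

[x⊕y]⊕z≡[x⊕z]⊕y : ∀ {n} (u v w : Cube n) → (u ⊕ v) ⊕ w ≡ (u ⊕ w) ⊕ v
[x⊕y]⊕z≡[x⊕z]⊕y []      []      []      = refl
[x⊕y]⊕z≡[x⊕z]⊕y (a ∷ u) (b ∷ v) (c ∷ w) = cong₂ _∷_ (xor.xy∙z≈xz∙y a b c) ([x⊕y]⊕z≡[x⊕z]⊕y u v w)

⟨⟩-comm : ∀ {n} (u v : Cube n) → ⟨ u , v ⟩ ≡ ⟨ v , u ⟩
⟨⟩-comm []      []      = refl
⟨⟩-comm (a ∷ u) (b ∷ v) = cong₂ _xor_ (𝔽₂.*-comm a b) (⟨⟩-comm u v)

⟨⟩-zeroˡ : ∀ {n} (v : Cube n) → ⟨ replicate n false , v ⟩ ≡ false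
⟨⟩-zeroˡ []      = refl
⟨⟩-zeroˡ (b ∷ v) = ⟨⟩-zeroˡ v

⟨⟩-⊕ʳ : ∀ {n} (w u v : Cube n) → ⟨ w , u ⊕ v ⟩ ≡ ⟨ w , u ⟩ xor ⟨ w , v ⟩
⟨⟩-⊕ʳ []      []      []      = refl
⟨⟩-⊕ʳ (a ∷ w) (b ∷ u) (c ∷ v) = begin
  (a ∧ (b xor c)) xor ⟨ w , u ⊕ v ⟩
    ≡⟨ cong₂ _xor_ (∧-distribˡ-xor a b c) (⟨⟩-⊕ʳ w u v) ⟩
  ((a ∧ b) xor (a ∧ c)) xor (⟨ w , u ⟩ xor ⟨ w , v ⟩)
    ≡⟨ xor.interchange (a ∧ b) (a ∧ c) ⟨ w , u ⟩ ⟨ w , v ⟩ ⟩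
  ((a ∧ b) xor ⟨ w , u ⟩) xor ((a ∧ c) xor ⟨ w , v ⟩) ∎

⟨⟩-⊕ˡ : ∀ {n} (u v w : Cube n) → ⟨ u ⊕ v , w ⟩ ≡ ⟨ u , w ⟩ xor ⟨ v , w ⟩
⟨⟩-⊕ˡ u v w = begin
  ⟨ u ⊕ v , w ⟩             ≡⟨ ⟨⟩-comm (u ⊕ v) w ⟩
  ⟨ w , u ⊕ v ⟩             ≡⟨ ⟨⟩-⊕ʳ w u v ⟩
  ⟨ w , u ⟩ xor ⟨ w , v ⟩   ≡⟨ cong₂ _xor_ (⟨⟩-comm w u) (⟨⟩-comm w v) ⟩
  ⟨ u , w ⟩ xor ⟨ v , w ⟩   ∎

⟨⟩-∧ˡ : ∀ {n} (b : Bool) (u v : Cube n) → ⟨ map (_∧ b) u , v ⟩ ≡ b ∧ ⟨ u , v ⟩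
⟨⟩-∧ˡ b []      []      = sym (∧-zeroʳ b)
⟨⟩-∧ˡ b (a ∷ u) (c ∷ v) = begin
  ((a ∧ b) ∧ c) xor ⟨ map (_∧ b) u , v ⟩  ≡⟨ cong₂ _xor_ (∧.xy∙z≈y∙xz a b c) (⟨⟩-∧ˡ b u v) ⟩
  (b ∧ (a ∧ c)) xor (b ∧ ⟨ u , v ⟩)        ≡⟨ ∧-distribˡ-xor b (a ∧ c) ⟨ u , v ⟩ ⟨
  b ∧ ((a ∧ c) xor ⟨ u , v ⟩)              ∎

-- Stated for rectangular matrices (k columns, m rows), as the induction on rows requires.
⟨⟩-transpose : ∀ {m k} (M : Vec (Cube k) m) (x : Cube m) (y : Cube k) →
  ⟨ x , map (λ r → ⟨ r , y ⟩) M ⟩ ≡ ⟨ map (λ c → ⟨ c , x ⟩) (transpose M) , y ⟩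
⟨⟩-transpose {k = k} [] [] y = sym (begin
  ⟨ map (λ c → ⟨ c , [] ⟩) (replicate k []) , y ⟩  ≡⟨ cong (λ v → ⟨ v , y ⟩) (Vec.map-replicate _ [] k) ⟩
  ⟨ replicate k false , y ⟩                        ≡⟨ ⟨⟩-zeroˡ y ⟩
  false                                            ∎)
⟨⟩-transpose {k = k} (r ∷ M) (b ∷ x) y = begin
  (b ∧ ⟨ r , y ⟩) xor ⟨ x , map (λ r → ⟨ r , y ⟩) M ⟩
    ≡⟨ cong₂ _xor_ (sym (⟨⟩-∧ˡ b r y)) (⟨⟩-transpose M x y) ⟩
  ⟨ map (_∧ b) r , y ⟩ xor ⟨ Mᵗx , y ⟩
    ≡⟨ ⟨⟩-⊕ˡ (map (_∧ b) r) Mᵗx y ⟨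
  ⟨ map (_∧ b) r ⊕ Mᵗx , y ⟩
    ≡⟨ cong (λ v → ⟨ v , y ⟩) (columns r (transpose M)) ⟨
  ⟨ map (λ c → ⟨ c , b ∷ x ⟩) (transpose (r ∷ M)) , y ⟩ ∎
  where
  Mᵗx : Cube k
  Mᵗx = map (λ c → ⟨ c , x ⟩) (transpose M)
  columns : ∀ {j} (r : Cube j) (C : Vec (Cube _) j) →
    map (λ c → ⟨ c , b ∷ x ⟩) ((replicate j _∷_ ⊛ r) ⊛ C) ≡ map (_∧ b) r ⊕ map (λ c → ⟨ c , x ⟩) C
  columns []      []      = refl
  columns (a ∷ r) (c ∷ C) = cong (_ ∷_) (columns r C)

-- Finite sums

∑ : List A → (A → ℚ) → ℚ
∑ xs f = sumℚ (lmap f xs)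

∑-cong : ∀ {f g : A → ℚ} → (∀ a → f a ≡ g a) → ∀ xs → ∑ xs f ≡ ∑ xs g
∑-cong f≡g []       = refl
∑-cong f≡g (x ∷ xs) = cong₂ _+_ (f≡g x) (∑-cong f≡g xs)

∑-zero : ∀ (xs : List A) → ∑ xs (λ _ → 0ℚ) ≡ 0ℚ
∑-zero []       = refl
∑-zero (x ∷ xs) = trans (+-identityˡ _) (∑-zero xs)

∑-+ : ∀ (f g : A → ℚ) xs → ∑ xs (λ a → f a + g a) ≡ ∑ xs f + ∑ xs g
∑-+ f g []       = refl
∑-+ f g (x ∷ xs) = trans (cong (f x + g x +_) (∑-+ f g xs)) (+ℚ.interchange (f x) (g x) (∑ xs f) (∑ xs g))

∑-*ˡ : ∀ c (f : A → ℚ) xs → ∑ xs (λ a → c * f a) ≡ c * ∑ xs f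
∑-*ˡ c f []       = sym (*-zeroʳ c)
∑-*ˡ c f (x ∷ xs) = trans (cong (c * f x +_) (∑-*ˡ c f xs)) (sym (*-distribˡ-+ c (f x) (∑ xs f)))

∑-*ʳ : ∀ c (f : A → ℚ) xs → ∑ xs (λ a → f a * c) ≡ ∑ xs f * c
∑-*ʳ c f []       = sym (*-zeroˡ c)
∑-*ʳ c f (x ∷ xs) = trans (cong (f x * c +_) (∑-*ʳ c f xs)) (sym (*-distribʳ-+ c (f x) (∑ xs f)))

∑-swap : ∀ (h : A → B → ℚ) xs ys →
  ∑ xs (λ a → ∑ ys (h a)) ≡ ∑ ys (λ b → ∑ xs (λ a → h a b))
∑-swap h []       ys = sym (∑-zero ys)
∑-swap h (x ∷ xs) ys =
  trans (cong (∑ ys (h x) +_) (∑-swap h xs ys)) (sym (∑-+ (h x) (λ b → ∑ xs (λ a → h a b)) ys))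

sumℚ-++ : ∀ ps qs → sumℚ (ps ++ qs) ≡ sumℚ ps + sumℚ qs
sumℚ-++ []       qs = sym (+-identityˡ (sumℚ qs))
sumℚ-++ (p ∷ ps) qs = trans (cong (p +_) (sumℚ-++ ps qs)) (sym (+-assoc p (sumℚ ps) (sumℚ qs)))

Σcube-suc : ∀ n (h : Cube (suc n) → ℚ) →
  Σcube (suc n) h ≡ Σcube n (λ v → h (false ∷ v)) + Σcube n (λ v → h (true ∷ v))
Σcube-suc n h = begin
  sumℚ (lmap h (lmap (false ∷_) cube ++ lmap (true ∷_) cube))
    ≡⟨ cong sumℚ (List.map-++ h (lmap (false ∷_) cube) (lmap (true ∷_) cube)) ⟩
  sumℚ (lmap h (lmap (false ∷_) cube) ++ lmap h (lmap (true ∷_) cube))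
    ≡⟨ sumℚ-++ (lmap h (lmap (false ∷_) cube)) (lmap h (lmap (true ∷_) cube)) ⟩
  sumℚ (lmap h (lmap (false ∷_) cube)) + sumℚ (lmap h (lmap (true ∷_) cube))
    ≡⟨ cong₂ (λ ps qs → sumℚ ps + sumℚ qs) (List.map-∘ cube) (List.map-∘ cube) ⟨
  Σcube n (λ v → h (false ∷ v)) + Σcube n (λ v → h (true ∷ v)) ∎
  where
  cube : List (Cube n)
  cube = allCube n

Σcube-translate : ∀ n (h : Cube n → ℚ) (a : Cube n) → Σcube n (λ u → h (a ⊕ u)) ≡ Σcube n h
Σcube-translate zero    h []          = refl
Σcube-translate (suc n) h (false ∷ a) = begin
  Σcube (suc n) (λ u → h ((false ∷ a) ⊕ u))
    ≡⟨ Σcube-suc n (λ u → h ((false ∷ a) ⊕ u)) ⟩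
  Σcube n (λ v → h (false ∷ (a ⊕ v))) + Σcube n (λ v → h (true ∷ (a ⊕ v)))
    ≡⟨ cong₂ _+_ (Σcube-translate n (λ v → h (false ∷ v)) a) (Σcube-translate n (λ v → h (true ∷ v)) a) ⟩
  Σcube n (λ v → h (false ∷ v)) + Σcube n (λ v → h (true ∷ v))
    ≡⟨ Σcube-suc n h ⟨
  Σcube (suc n) h ∎
Σcube-translate (suc n) h (true ∷ a) = begin
  Σcube (suc n) (λ u → h ((true ∷ a) ⊕ u))
    ≡⟨ Σcube-suc n (λ u → h ((true ∷ a) ⊕ u)) ⟩
  Σcube n (λ v → h (true ∷ (a ⊕ v))) + Σcube n (λ v → h (false ∷ (a ⊕ v)))
    ≡⟨ cong₂ _+_ (Σcube-translate n (λ v → h (true ∷ v)) a) (Σcube-translate n (λ v → h (false ∷ v)) a) ⟩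
  Σcube n (λ v → h (true ∷ v)) + Σcube n (λ v → h (false ∷ v))
    ≡⟨ +-comm (Σcube n (λ v → h (true ∷ v))) (Σcube n (λ v → h (false ∷ v))) ⟩
  Σcube n (λ v → h (false ∷ v)) + Σcube n (λ v → h (true ∷ v))
    ≡⟨ Σcube-suc n h ⟨
  Σcube (suc n) h ∎

𝔼-cong : ∀ n {g h : Cube n → ℚ} → (∀ u → g u ≡ h u) → 𝔼 n g ≡ 𝔼 n h
𝔼-cong n g≡h = cong (half^ n *_) (∑-cong g≡h (allCube n))

𝔼-*ˡ : ∀ n c (h : Cube n → ℚ) → 𝔼 n (λ u → c * h u) ≡ c * 𝔼 n h
𝔼-*ˡ n c h = trans (cong (half^ n *_) (∑-*ˡ c h (allCube n))) (*ℚ.x∙yz≈y∙xz (half^ n) c (Σcube n h))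

𝔼-*ʳ : ∀ n c (h : Cube n → ℚ) → 𝔼 n (λ u → h u * c) ≡ 𝔼 n h * c
𝔼-*ʳ n c h = trans (cong (half^ n *_) (∑-*ʳ c h (allCube n))) (sym (*-assoc (half^ n) (Σcube n h) c))

𝔼-swap : ∀ n (H : Cube n → Cube n → ℚ) → 𝔼 n (λ a → 𝔼 n (H a)) ≡ 𝔼 n (λ b → 𝔼 n (λ a → H a b))
𝔼-swap n H = begin
  N * Σcube n (λ a → N * Σcube n (H a))
    ≡⟨ cong (N *_) (∑-*ˡ N (λ a → Σcube n (H a)) (allCube n)) ⟩
  N * (N * Σcube n (λ a → Σcube n (H a)))
    ≡⟨ cong (λ t → N * (N * t)) (∑-swap H (allCube n) (allCube n)) ⟩
  N * (N * Σcube n (λ b → Σcube n (λ a → H a b)))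
    ≡⟨ cong (N *_) (∑-*ˡ N (λ b → Σcube n (λ a → H a b)) (allCube n)) ⟨
  N * Σcube n (λ b → N * Σcube n (λ a → H a b)) ∎
  where
  N : ℚ
  N = half^ n

𝔼-translate : ∀ n (h : Cube n → ℚ) (a : Cube n) → 𝔼 n (λ u → h (a ⊕ u)) ≡ 𝔼 n h
𝔼-translate n h a = cong (half^ n *_) (Σcube-translate n h a)

𝔼-suc : ∀ n (h : Cube (suc n) → ℚ) →
  𝔼 (suc n) h ≡ ½ * (𝔼 n (λ v → h (false ∷ v)) + 𝔼 n (λ v → h (true ∷ v)))
𝔼-suc n h = begin
  ½ * N * Σcube (suc n) h
    ≡⟨ *-assoc ½ N (Σcube (suc n) h) ⟩
  ½ * (N * Σcube (suc n) h)
    ≡⟨ cong (λ t → ½ * (N * t)) (Σcube-suc n h) ⟩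
  ½ * (N * (Σcube n (λ v → h (false ∷ v)) + Σcube n (λ v → h (true ∷ v))))
    ≡⟨ cong (½ *_) (*-distribˡ-+ N (Σcube n (λ v → h (false ∷ v))) (Σcube n (λ v → h (true ∷ v)))) ⟩
  ½ * (𝔼 n (λ v → h (false ∷ v)) + 𝔼 n (λ v → h (true ∷ v))) ∎
  where
  N : ℚ
  N = half^ n

-- Characters and their orthogonality

χ : ∀ {n} → Cube n → Cube n → ℚ
χ α u = sgn ⟨ α , u ⟩

sgn-xor : ∀ a b → sgn (a xor b) ≡ sgn a * sgn b
sgn-xor false false = refl
sgn-xor false true  = refl
sgn-xor true  false = refl
sgn-xor true  true  = refl

sgn-not : ∀ a → sgn (not a) ≡ - 1ℚ * sgn a
sgn-not false = refl
sgn-not true  = refl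

χ-⊕ʳ : ∀ {n} (α u v : Cube n) → χ α (u ⊕ v) ≡ χ α u * χ α v
χ-⊕ʳ α u v = trans (cong sgn (⟨⟩-⊕ʳ α u v)) (sgn-xor ⟨ α , u ⟩ ⟨ α , v ⟩)

χ-comm : ∀ {n} (α u : Cube n) → χ α u ≡ χ u α
χ-comm α u = cong sgn (⟨⟩-comm α u)

δ : ∀ {n} → Cube n → ℚ
δ {n} a = 𝔼 n (λ α → χ α a)

δ-false∷ : ∀ {n} (a : Cube n) → δ (false ∷ a) ≡ δ a
δ-false∷ {n} a = trans (𝔼-suc n (λ α → χ α (false ∷ a))) (½[x+x]≡x (δ a))
  where
  open +-*-Solver
  ½[x+x]≡x : ∀ x → ½ * (x + x) ≡ x
  ½[x+x]≡x = solve 1 (λ x → con ½ :* (x :+ x) := x) refl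

δ-true∷ : ∀ {n} (a : Cube n) → δ (true ∷ a) ≡ 0ℚ
δ-true∷ {n} a = begin
  δ (true ∷ a)
    ≡⟨ 𝔼-suc n (λ α → χ α (true ∷ a)) ⟩
  ½ * (δ a + 𝔼 n (λ α → sgn (not ⟨ α , a ⟩)))
    ≡⟨ cong (λ t → ½ * (δ a + t)) (trans (𝔼-cong n (λ α → sgn-not ⟨ α , a ⟩)) (𝔼-*ˡ n (- 1ℚ) (λ α → χ α a))) ⟩
  ½ * (δ a + - 1ℚ * δ a)
    ≡⟨ ½[x-x]≡0 (δ a) ⟩
  0ℚ ∎
  where
  open +-*-Solver
  ½[x-x]≡0 : ∀ x → ½ * (x + - 1ℚ * x) ≡ 0ℚ
  ½[x-x]≡0 = solve 1 (λ x → con ½ :* (x :+ con (- 1ℚ) :* x) := con 0ℚ) refl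

Σcube-δ : ∀ n (h : Cube n → ℚ) → Σcube n (λ v → h v * δ v) ≡ h (replicate n false)
Σcube-δ zero    h = trans (+-identityʳ (h [] * 1ℚ)) (*-identityʳ (h []))
Σcube-δ (suc n) h = begin
  Σcube (suc n) (λ v → h v * δ v)
    ≡⟨ Σcube-suc n (λ v → h v * δ v) ⟩
  Σcube n (λ v → h (false ∷ v) * δ (false ∷ v)) + Σcube n (λ v → h (true ∷ v) * δ (true ∷ v))
    ≡⟨ cong₂ _+_ (∑-cong (λ v → cong (h (false ∷ v) *_) (δ-false∷ v)) (allCube n))
                 (∑-cong (λ v → trans (cong (h (true ∷ v) *_) (δ-true∷ v)) (*-zeroʳ (h (true ∷ v)))) (allCube n)) ⟩
  Σcube n (λ v → h (false ∷ v) * δ v) + Σcube n (λ _ → 0ℚ)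
    ≡⟨ cong₂ _+_ (Σcube-δ n (λ v → h (false ∷ v))) (∑-zero (allCube n)) ⟩
  h (replicate (suc n) false) + 0ℚ
    ≡⟨ +-identityʳ (h (replicate (suc n) false)) ⟩
  h (replicate (suc n) false) ∎

Σcube-δ-translate : ∀ n (h : Cube n → ℚ) (c : Cube n) → Σcube n (λ v → h v * δ (v ⊕ c)) ≡ h c
Σcube-δ-translate n h c = begin
  Σcube n (λ v → h v * δ (v ⊕ c))
    ≡⟨ ∑-cong (λ v → cong₂ (λ w z → h w * δ z) (sym (x⊕[x⊕y]≡y c v)) (⊕-comm v c)) (allCube n) ⟩
  Σcube n (λ v → h (c ⊕ (c ⊕ v)) * δ (c ⊕ v))
    ≡⟨ Σcube-translate n (λ w → h (c ⊕ w) * δ w) c ⟩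
  Σcube n (λ w → h (c ⊕ w) * δ w)
    ≡⟨ Σcube-δ n (λ w → h (c ⊕ w)) ⟩
  h (c ⊕ replicate n false)
    ≡⟨ cong h (⊕-identityʳ c) ⟩
  h c ∎

-- Fourier transform

hat-translate : ∀ {n} (h : Cube n → ℚ) (a x : Cube n) → hat (λ z → h (a ⊕ z)) x ≡ hat h x * χ x a
hat-translate {n} h a x = begin
  𝔼 n (λ z → h (a ⊕ z) * χ x z)
    ≡⟨ 𝔼-cong n (λ z → cong (λ w → h (a ⊕ z) * χ x w) (sym (x⊕[x⊕y]≡y a z))) ⟩
  𝔼 n (λ z → h (a ⊕ z) * χ x (a ⊕ (a ⊕ z)))
    ≡⟨ 𝔼-translate n (λ z → h z * χ x (a ⊕ z)) a ⟩
  𝔼 n (λ z → h z * χ x (a ⊕ z))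
    ≡⟨ 𝔼-cong n (λ z → trans (cong (h z *_) (χ-⊕ʳ x a z)) (*ℚ.x∙yz≈xz∙y (h z) (χ x a) (χ x z))) ⟩
  𝔼 n (λ z → h z * χ x z * χ x a)
    ≡⟨ 𝔼-*ʳ n (χ x a) (λ z → h z * χ x z) ⟩
  hat h x * χ x a ∎

hat-hat : ∀ {n} (h : Cube n → ℚ) (x : Cube n) → hat (hat h) x ≡ half^ n * h x
hat-hat {n} h x = begin
  𝔼 n (λ α → hat h α * χ x α)
    ≡⟨ 𝔼-cong n (λ α → 𝔼-*ʳ n (χ x α) (λ u → h u * χ α u)) ⟨
  𝔼 n (λ α → 𝔼 n (λ u → h u * χ α u * χ x α))
    ≡⟨ 𝔼-swap n (λ α u → h u * χ α u * χ x α) ⟩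
  𝔼 n (λ u → 𝔼 n (λ α → h u * χ α u * χ x α))
    ≡⟨ 𝔼-cong n (λ u → 𝔼-cong n (λ α → merge-χ u α)) ⟩
  𝔼 n (λ u → 𝔼 n (λ α → h u * χ α (u ⊕ x)))
    ≡⟨ 𝔼-cong n (λ u → 𝔼-*ˡ n (h u) (λ α → χ α (u ⊕ x))) ⟩
  half^ n * Σcube n (λ u → h u * δ (u ⊕ x))
    ≡⟨ cong (half^ n *_) (Σcube-δ-translate n h x) ⟩
  half^ n * h x ∎
  where
  merge-χ : ∀ u α → h u * χ α u * χ x α ≡ h u * χ α (u ⊕ x)
  merge-χ u α = begin
    h u * χ α u * χ x α      ≡⟨ *-assoc (h u) (χ α u) (χ x α) ⟩
    h u * (χ α u * χ x α)    ≡⟨ cong (λ t → h u * (χ α u * t)) (χ-comm x α) ⟩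
    h u * (χ α u * χ α x)    ≡⟨ cong (h u *_) (χ-⊕ʳ α u x) ⟨
    h u * χ α (u ⊕ x)        ∎

autocorrelation : ∀ {n} → (Cube n → ℚ) → Cube n → ℚ
autocorrelation {n} h y = 𝔼 n (λ u → h u * h (u ⊕ y))

hat-autocorrelation : ∀ {n} (h : Cube n → ℚ) (c : Cube n) → hat (autocorrelation h) c ≡ hat h c * hat h c
hat-autocorrelation {n} h c = begin
  𝔼 n (λ y → 𝔼 n (λ u → h u * h (u ⊕ y)) * χ c y)
    ≡⟨ 𝔼-cong n (λ y → 𝔼-*ʳ n (χ c y) (λ u → h u * h (u ⊕ y))) ⟨
  𝔼 n (λ y → 𝔼 n (λ u → h u * h (u ⊕ y) * χ c y))
    ≡⟨ 𝔼-swap n (λ y u → h u * h (u ⊕ y) * χ c y) ⟩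
  𝔼 n (λ u → 𝔼 n (λ y → h u * h (u ⊕ y) * χ c y))
    ≡⟨ 𝔼-cong n (λ u → trans (𝔼-cong n (λ y → *-assoc (h u) (h (u ⊕ y)) (χ c y)))
                             (𝔼-*ˡ n (h u) (λ y → h (u ⊕ y) * χ c y))) ⟩
  𝔼 n (λ u → h u * hat (λ y → h (u ⊕ y)) c)
    ≡⟨ 𝔼-cong n (λ u → cong (h u *_) (hat-translate h u c)) ⟩
  𝔼 n (λ u → h u * (hat h c * χ c u))
    ≡⟨ 𝔼-cong n (λ u → *ℚ.x∙yz≈xz∙y (h u) (hat h c) (χ c u)) ⟩
  𝔼 n (λ u → h u * χ c u * hat h c)
    ≡⟨ 𝔼-*ʳ n (hat h c) (λ u → h u * χ c u) ⟩
  hat h c * hat h c ∎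

hat-square : ∀ {n} (g : Cube n → ℚ) (x : Cube n) →
  hat (λ z → hat g z * hat g z) x ≡ half^ n * autocorrelation g x
hat-square {n} g x = begin
  hat (λ z → hat g z * hat g z) x
    ≡⟨ 𝔼-cong n (λ z → cong (_* χ x z) (hat-autocorrelation g z)) ⟨
  hat (hat (autocorrelation g)) x
    ≡⟨ hat-hat (autocorrelation g) x ⟩
  half^ n * autocorrelation g x ∎

hat-Σcube : ∀ {n} (H : Cube n → Cube n → ℚ) (x : Cube n) →
  hat (λ z → Σcube n (λ y → H y z)) x ≡ Σcube n (λ y → hat (H y) x)
hat-Σcube {n} H x = begin
  half^ n * Σcube n (λ z → Σcube n (λ y → H y z) * χ x z)
    ≡⟨ cong (half^ n *_) (∑-cong (λ z → ∑-*ʳ (χ x z) (λ y → H y z) (allCube n)) (allCube n)) ⟨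
  half^ n * Σcube n (λ z → Σcube n (λ y → H y z * χ x z))
    ≡⟨ cong (half^ n *_) (∑-swap (λ z y → H y z * χ x z) (allCube n) (allCube n)) ⟩
  half^ n * Σcube n (λ y → Σcube n (λ z → H y z * χ x z))
    ≡⟨ ∑-*ˡ (half^ n) (λ y → Σcube n (λ z → H y z * χ x z)) (allCube n) ⟨
  Σcube n (λ y → hat (H y) x) ∎

autocorrelation-deriv-comm : ∀ {n} (f : Cube n → ℚ) (x y : Cube n) →
  autocorrelation (deriv f y) x ≡ autocorrelation (deriv f x) y
autocorrelation-deriv-comm {n} f x y = 𝔼-cong n λ u → begin
  f u * f (u ⊕ y) * (f (u ⊕ x) * f ((u ⊕ x) ⊕ y))
    ≡⟨ cong (λ w → f u * f (u ⊕ y) * (f (u ⊕ x) * f w)) ([x⊕y]⊕z≡[x⊕z]⊕y u x y) ⟩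
  f u * f (u ⊕ y) * (f (u ⊕ x) * f ((u ⊕ y) ⊕ x))
    ≡⟨ *ℚ.interchange (f u) (f (u ⊕ y)) (f (u ⊕ x)) (f ((u ⊕ y) ⊕ x)) ⟩
  f u * f (u ⊕ x) * (f (u ⊕ y) * f ((u ⊕ y) ⊕ x)) ∎

lemma6p10 : (n : ℕ) (f : Cube n → ℚ) → (∀ u → f u ≡ 1ℚ ⊎ f u ≡ - 1ℚ) →
    (D : Mat n) → (x : Cube n) →
      hat (bigF f D) x ≡ hat (deriv f x) ((D ᵗ) · x) * hat (deriv f x) ((D ᵗ) · x)
-- The identity holds for every rational-valued f.
lemma6p10 n f _ D x = begin
  hat (bigF f D) x
    ≡⟨ hat-Σcube (λ y z → G y ((D · y) ⊕ z)) x ⟩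
  Σcube n (λ y → hat (λ z → G y ((D · y) ⊕ z)) x)
    ≡⟨ ∑-cong (λ y → hat-translate (G y) (D · y) x) (allCube n) ⟩
  Σcube n (λ y → hat (G y) x * χ x (D · y))
    ≡⟨ ∑-cong (λ y → cong₂ _*_ (hat-square (deriv f y) x) (cong sgn (⟨⟩-transpose D x y))) (allCube n) ⟩
  Σcube n (λ y → half^ n * autocorrelation (deriv f y) x * χ c y)
    ≡⟨ ∑-cong (λ y → trans (cong (λ t → half^ n * t * χ c y) (autocorrelation-deriv-comm f x y))
                           (*-assoc (half^ n) (autocorrelation h y) (χ c y))) (allCube n) ⟩
  Σcube n (λ y → half^ n * (autocorrelation h y * χ c y))
    ≡⟨ ∑-*ˡ (half^ n) (λ y → autocorrelation h y * χ c y) (allCube n) ⟩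
  hat (autocorrelation h) c
    ≡⟨ hat-autocorrelation h c ⟩
  hat h c * hat h c ∎
  where
  G : Cube n → Cube n → ℚ
  G y z = hat (deriv f y) z * hat (deriv f y) z
  h : Cube n → ℚ
  h = deriv f x
  c : Cube n
  c = (D ᵗ) · x
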